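{- Let $X$ be a topological space, $Y$ an Alexandroff space, $f:X\to Y$ a continuous surjection, and $\mathcal{S}=(\mathcal{O}(Y),\nabla_Y)$ a spacetime. Then there exists $\nabla_X:\mathcal{O}(X)\to\mathcal{O}(X)$ such that $\mathcal{T}=(\mathcal{O}(X),\nabla_X)$ is a spacetime and $f^{ -1}:\mathcal{S}\to\mathcal{T}$ is a logical morphism.
   Context: $\mathcal{O}(X)$ denotes the locale of open subsets of $X$ ordered by inclusion, with binary meet $\cap$ and top $X$. A topological space is Alexandroff if arbitrary intersections of open sets are open. A spacetime is a pair $(\mathscr{X},\nabla)$ where $\mathscr{X}$ is a locale (a complete lattice in which finite meets distribute over arbitrary joins, regarded as a quantale with multiplication $\wedge$ and unit the top) and $\nabla:\mathscr{X}\to\mathscr{X}$ is a join preserving map. Its implication $\to$ is defined by $a\wedge\nabla b\leq c$ iff $b\leq a\to c$. A logical morphism $g:(\mathscr{X},\nabla_1)\to(\mathscr{Y},\nabla_2)$ is a map preserving all joins and finite meets with $g\nabla_1=\nabla_2 g$ and $g(a\to_1 b)=g(a)\to_2 g(b)$ for all $a,b$. -}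

module Defs where

open import Level using (Level; suc; _⊔_)
open import Data.Product using (Σ; _×_; _,_; proj₁)
open import Data.Unit.Polymorphic using (⊤)
open import Relation.Binary.PropositionalEquality using (_≡_)

Subset : ∀ {ℓ} → Set ℓ → Set (suc ℓ)
Subset {ℓ} X = X → Set ℓ

_⊆_ : ∀ {ℓ} {X : Set ℓ} → Subset X → Subset X → Set ℓ
A ⊆ B = ∀ x → A x → B x

_≐_ : ∀ {ℓ} {X : Set ℓ} → Subset X → Subset X → Set ℓ
A ≐ B = (A ⊆ B) × (B ⊆ A)

Union : ∀ {ℓ} {X I : Set ℓ} → (I → Subset X) → Subset X
Union {I = I} F x = Σ I (λ i → F i x)

Inter : ∀ {ℓ} {X I : Set ℓ} → (I → Subset X) → Subset X
Inter {I = I} F x = (i : I) → F i x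

_∩ˢ_ : ∀ {ℓ} {X : Set ℓ} → Subset X → Subset X → Subset X
(A ∩ˢ B) x = A x × B x

Full : ∀ {ℓ} {X : Set ℓ} → Subset X
Full x = ⊤

-- A topology on X (predicatively): a type Opn of (codes of) open sets, each
-- denoting a subset of X; the opens are the subsets ⟦ U ⟧.
record Topology {ℓ} (X : Set ℓ) : Set (suc ℓ) where
  field
    Opn    : Set ℓ
    ⟦_⟧    : Opn → Subset X
    ⋃      : {I : Set ℓ} → (I → Opn) → Opn
    ⋃-sem  : {I : Set ℓ} (F : I → Opn) → ⟦ ⋃ F ⟧ ≐ Union (λ i → ⟦ F i ⟧)
    _∩_    : Opn → Opn → Opn
    ∩-sem  : (U V : Opn) → ⟦ U ∩ V ⟧ ≐ (⟦ U ⟧ ∩ˢ ⟦ V ⟧)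
    top    : Opn
    top-sem : ⟦ top ⟧ ≐ Full

  _≤_ : Opn → Opn → Set ℓ
  U ≤ V = ⟦ U ⟧ ⊆ ⟦ V ⟧

  _≈_ : Opn → Opn → Set ℓ
  U ≈ V = ⟦ U ⟧ ≐ ⟦ V ⟧

open Topology public

Alexandroff : ∀ {ℓ} {X : Set ℓ} → Topology X → Set (suc ℓ)
Alexandroff {ℓ} τ =
  {I : Set ℓ} (F : I → Opn τ) → Σ (Opn τ) (λ U → ⟦ τ ⟧ U ≐ Inter (λ i → ⟦ τ ⟧ (F i)))

record Continuous {ℓ} {X Y : Set ℓ} (τX : Topology X) (τY : Topology Y)
                  (f : X → Y) : Set (suc ℓ) where
  field
    pre     : Opn τY → Opn τX
    pre-sem : (V : Opn τY) → ⟦ τX ⟧ (pre V) ≐ (λ x → ⟦ τY ⟧ V (f x))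

open Continuous public

Surjective : ∀ {ℓ} {X Y : Set ℓ} → (X → Y) → Set ℓ
Surjective {X = X} f = ∀ y → Σ X (λ x → f x ≡ y)

-- A spacetime structure on the locale O(X): a join preserving map ∇.
-- (cong: ∇ is a well-defined map on O(X), whose elements are open subsets.)
record Spacetime {ℓ} {X : Set ℓ} (τ : Topology X) : Set (suc ℓ) where
  field
    ∇        : Opn τ → Opn τ
    ∇-cong   : {U V : Opn τ} → _≈_ τ U V → _≈_ τ (∇ U) (∇ V)
    ∇-joins  : {I : Set ℓ} (F : I → Opn τ) →
               _≈_ τ (∇ (⋃ τ F)) (⋃ τ (λ i → ∇ (F i)))

  -- implication: a → c = ⋁ { b | a ∧ ∇ b ≤ c }, so that a ∧ ∇ b ≤ c iff b ≤ a → c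
  _⇒_ : Opn τ → Opn τ → Opn τ
  a ⇒ c = ⋃ τ {I = Σ (Opn τ) (λ b → _≤_ τ (_∩_ τ a (∇ b)) c)} (λ p → proj₁ p)

open Spacetime public

record IsLogicalMorphism {ℓ} {Y X : Set ℓ} {τY : Topology Y} {τX : Topology X}
         (S : Spacetime τY) (T : Spacetime τX) (g : Opn τY → Opn τX) : Set (suc ℓ) where
  field
    g-cong  : {U V : Opn τY} → _≈_ τY U V → _≈_ τX (g U) (g V)
    g-joins : {I : Set ℓ} (F : I → Opn τY) →
              _≈_ τX (g (⋃ τY F)) (⋃ τX (λ i → g (F i)))
    g-meet  : (U V : Opn τY) → _≈_ τX (g (_∩_ τY U V)) (_∩_ τX (g U) (g V))
    g-top   : _≈_ τX (g (top τY)) (top τX)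
    g-∇     : (U : Opn τY) → _≈_ τX (g (∇ S U)) (∇ T (g U))
    g-⇒     : (a b : Opn τY) → _≈_ τX (g (_⇒_ S a b)) (_⇒_ T (g a) (g b))

-- For continuous f : X → Y the preimage map f⁻¹ : O(Y) → O(X) preserves
-- all joins and finite meets.  When Y is Alexandroff it also has a left adjoint
-- f₊ : O(X) → O(Y), sending U to the smallest open V with U ⊆ f⁻¹ V (the
-- intersection of all such V, open because Y is Alexandroff).  Being a left
-- adjoint, f₊ preserves joins, and if f is surjective then f⁻¹ reflects the
-- order, so f₊ (f⁻¹ V) = V.  We put  ∇X = f⁻¹ ∘ ∇Y ∘ f₊ : a composite of join
-- preserving maps, hence a spacetime, and f⁻¹ ∇Y = f⁻¹ ∇Y f₊ f⁻¹ = ∇X f⁻¹.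
-- Finally f⁻¹ commutes with the implications because, in any spacetime,
-- a → c is the largest b with a ∧ ∇ b ≤ c (introduction and modus ponens).
module Submission where

open import Defs hiding (Opn; ⟦_⟧; ⋃; ⋃-sem; _∩_; ∩-sem; top; top-sem; _≤_; _≈_;
                         ∇; ∇-cong; ∇-joins; _⇒_)
open import Data.Product using (Σ; _,_; proj₁; proj₂)
open import Relation.Binary.Bundles using (Preorder)
open import Relation.Binary.PropositionalEquality using (refl)
import Relation.Binary.Reasoning.Preorder as PreorderReasoning

module OpenLattice {ℓ} {X : Set ℓ} (τ : Topology X) where
  open Topology τ public

  ≤-refl : ∀ {U} → U ≤ U
  ≤-refl x h = h

  ≤-trans : ∀ {U V W} → U ≤ V → V ≤ W → U ≤ W
  ≤-trans U≤V V≤W x h = V≤W x (U≤V x h)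

  ≈-refl : ∀ {U} → U ≈ U
  ≈-refl = ≤-refl , ≤-refl

  ≈-sym : ∀ {U V} → U ≈ V → V ≈ U
  ≈-sym (U≤V , V≤U) = V≤U , U≤V

  ≈-trans : ∀ {U V W} → U ≈ V → V ≈ W → U ≈ W
  ≈-trans (U≤V , V≤U) (V≤W , W≤V) = ≤-trans U≤V V≤W , ≤-trans W≤V V≤U

  ≤-preorder : Preorder ℓ ℓ ℓ
  ≤-preorder = record
    { Carrier    = Opn
    ; _≈_        = _≈_
    ; _≲_        = _≤_
    ; isPreorder = record
      { isEquivalence = record { refl = ≈-refl ; sym = ≈-sym ; trans = ≈-trans }
      ; reflexive     = proj₁
      ; trans         = ≤-trans
      }
    }

  module ≤-Reasoning = PreorderReasoning ≤-preorder

  ⋃-upper : ∀ {I : Set ℓ} (F : I → Opn) i → F i ≤ ⋃ F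
  ⋃-upper F i x h = proj₂ (⋃-sem F) x (i , h)

  ⋃-least : ∀ {I : Set ℓ} {F : I → Opn} {U} → (∀ i → F i ≤ U) → ⋃ F ≤ U
  ⋃-least {F = F} bound x h with proj₁ (⋃-sem F) x h
  ... | i , hi = bound i x hi

  ∩-lower₁ : ∀ {U V} → (U ∩ V) ≤ U
  ∩-lower₁ {U} {V} x h = proj₁ (proj₁ (∩-sem U V) x h)

  ∩-lower₂ : ∀ {U V} → (U ∩ V) ≤ V
  ∩-lower₂ {U} {V} x h = proj₂ (proj₁ (∩-sem U V) x h)

  ∩-greatest : ∀ {W U V} → W ≤ U → W ≤ V → W ≤ (U ∩ V)
  ∩-greatest {U = U} {V} W≤U W≤V x h = proj₂ (∩-sem U V) x (W≤U x h , W≤V x h)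

  ∩-mono : ∀ {U U′ V V′} → U ≤ U′ → V ≤ V′ → (U ∩ V) ≤ (U′ ∩ V′)
  ∩-mono U≤U′ V≤V′ = ∩-greatest (≤-trans ∩-lower₁ U≤U′) (≤-trans ∩-lower₂ V≤V′)

-- In every spacetime, a → c is the largest b with a ∧ ∇ b ≤ c: any such b lies
-- below a → c, and a → c itself satisfies a ∧ ∇ (a → c) ≤ c because ∇
-- preserves the join defining a → c.
module Implication {ℓ} {X : Set ℓ} {τ : Topology X} (S : Spacetime τ) where
  open OpenLattice τ
  open Spacetime S

  ⇒-intro : ∀ {a b c} → (a ∩ ∇ b) ≤ c → b ≤ (a ⇒ c)
  ⇒-intro {a} {b} {c} a∧∇b≤c = ⋃-upper proj₁ (b , a∧∇b≤c)

  ⇒-elim : ∀ {a c} → (a ∩ ∇ (a ⇒ c)) ≤ c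
  ⇒-elim {a} {c} x h with proj₁ (⋃-sem _) x (proj₁ (∇-joins proj₁) x (∩-lower₂ x h))
  ... | (b , a∧∇b≤c) , x∈∇b = a∧∇b≤c x (proj₂ (∩-sem a (∇ b)) x (∩-lower₁ x h , x∈∇b))

module Preimage {ℓ} {X Y : Set ℓ} {τX : Topology X} {τY : Topology Y} {f : X → Y}
                (cont : Continuous τX τY f) where
  private
    module X = OpenLattice τX
    module Y = OpenLattice τY

  f⁻¹ : Y.Opn → X.Opn
  f⁻¹ = pre cont

  pre-elim : ∀ V x → X.⟦ f⁻¹ V ⟧ x → Y.⟦ V ⟧ (f x)
  pre-elim V = proj₁ (pre-sem cont V)

  pre-intro : ∀ V x → Y.⟦ V ⟧ (f x) → X.⟦ f⁻¹ V ⟧ x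
  pre-intro V = proj₂ (pre-sem cont V)

  pre-mono : ∀ {V W} → V Y.≤ W → f⁻¹ V X.≤ f⁻¹ W
  pre-mono {V} {W} V≤W x h = pre-intro W x (V≤W (f x) (pre-elim V x h))

  pre-cong : ∀ {V W} → V Y.≈ W → f⁻¹ V X.≈ f⁻¹ W
  pre-cong (V≤W , W≤V) = pre-mono V≤W , pre-mono W≤V

  pre-joins : ∀ {I : Set ℓ} (F : I → Y.Opn) → f⁻¹ (Y.⋃ F) X.≈ X.⋃ (λ i → f⁻¹ (F i))
  pre-joins F =
      (λ x h → let (i , hi) = proj₁ (Y.⋃-sem F) (f x) (pre-elim _ x h)
               in X.⋃-upper _ i x (pre-intro (F i) x hi))
    , X.⋃-least (λ i → pre-mono (Y.⋃-upper F i))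

  pre-meets : ∀ U V → f⁻¹ (U Y.∩ V) X.≈ (f⁻¹ U X.∩ f⁻¹ V)
  pre-meets U V =
      X.∩-greatest (pre-mono Y.∩-lower₁) (pre-mono Y.∩-lower₂)
    , λ x h → pre-intro _ x (proj₂ (Y.∩-sem U V) (f x)
                               (pre-elim U x (X.∩-lower₁ x h) , pre-elim V x (X.∩-lower₂ x h)))

  pre-top : f⁻¹ Y.top X.≈ X.top
  pre-top = (λ x _ → proj₂ X.top-sem x _) , (λ x _ → pre-intro _ x (proj₂ Y.top-sem (f x) _))

  pre-reflects : Surjective f → ∀ {V W} → f⁻¹ V X.≤ f⁻¹ W → V Y.≤ W
  pre-reflects surj {V} {W} fV≤fW y y∈V with surj y
  ... | x , refl = pre-elim W x (fV≤fW x (pre-intro V x y∈V))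

-- Over an Alexandroff codomain, f⁻¹ has a left adjoint f₊ : f₊ U is the
-- intersection of all opens whose preimage contains U.
module DirectImage {ℓ} {X Y : Set ℓ} {τX : Topology X} {τY : Topology Y} {f : X → Y}
                   (cont : Continuous τX τY f) (alex : Alexandroff τY) where
  private
    module X = OpenLattice τX
    module Y = OpenLattice τY
  open Preimage cont

  Covers : X.Opn → Set ℓ
  Covers U = Σ Y.Opn (λ V → U X.≤ f⁻¹ V)

  f₊ : X.Opn → Y.Opn
  f₊ U = proj₁ (alex {I = Covers U} proj₁)

  f₊-sem : ∀ U → Y.⟦ f₊ U ⟧ ≐ Inter (λ (c : Covers U) → Y.⟦ proj₁ c ⟧)
  f₊-sem U = proj₂ (alex {I = Covers U} proj₁)

  f₊-unit : ∀ U → U X.≤ f⁻¹ (f₊ U)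
  f₊-unit U x x∈U = pre-intro (f₊ U) x (proj₂ (f₊-sem U) (f x) λ (V , U≤fV) → pre-elim V x (U≤fV x x∈U))

  f₊-least : ∀ {U V} → U X.≤ f⁻¹ V → f₊ U Y.≤ V
  f₊-least {U} {V} U≤fV y y∈f₊U = proj₁ (f₊-sem U) y y∈f₊U (V , U≤fV)

  f₊-mono : ∀ {U U′} → U X.≤ U′ → f₊ U Y.≤ f₊ U′
  f₊-mono U≤U′ = f₊-least (X.≤-trans U≤U′ (f₊-unit _))

  f₊-cong : ∀ {U U′} → U X.≈ U′ → f₊ U Y.≈ f₊ U′
  f₊-cong (U≤U′ , U′≤U) = f₊-mono U≤U′ , f₊-mono U′≤U

  -- a left adjoint preserves joins
  f₊-joins : ∀ {I : Set ℓ} (F : I → X.Opn) → f₊ (X.⋃ F) Y.≈ Y.⋃ (λ i → f₊ (F i))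
  f₊-joins F =
      f₊-least (X.⋃-least λ i → X.≤-trans (f₊-unit (F i)) (pre-mono (Y.⋃-upper _ i)))
    , Y.⋃-least (λ i → f₊-mono (X.⋃-upper F i))

  -- surjectivity makes f⁻¹ order-reflecting, so the counit f₊ f⁻¹ V ≤ V is invertible
  f₊-retracts : Surjective f → ∀ V → f₊ (f⁻¹ V) Y.≈ V
  f₊-retracts surj V = f₊-least X.≤-refl , pre-reflects surj (f₊-unit (f⁻¹ V))

module Transport {ℓ} {X Y : Set ℓ} {τX : Topology X} {τY : Topology Y} {f : X → Y}
                 (cont : Continuous τX τY f) (alex : Alexandroff τY)
                 (surj : Surjective f) (S : Spacetime τY) where
  private
    module X = OpenLattice τX
    module Y = OpenLattice τY
    module SY = Spacetime S
  open Preimage cont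
  open DirectImage cont alex

  ∇X : X.Opn → X.Opn
  ∇X U = f⁻¹ (SY.∇ (f₊ U))

  ∇X-joins : ∀ {I : Set ℓ} (F : I → X.Opn) → ∇X (X.⋃ F) X.≈ X.⋃ (λ i → ∇X (F i))
  ∇X-joins F = begin-equality
    f⁻¹ (SY.∇ (f₊ (X.⋃ F)))                   ≈⟨ pre-cong (SY.∇-cong (f₊-joins F)) ⟩
    f⁻¹ (SY.∇ (Y.⋃ (λ i → f₊ (F i))))         ≈⟨ pre-cong (SY.∇-joins _) ⟩
    f⁻¹ (Y.⋃ (λ i → SY.∇ (f₊ (F i))))         ≈⟨ pre-joins _ ⟩
    X.⋃ (λ i → ∇X (F i))                      ∎
    where open X.≤-Reasoning

  T : Spacetime τX
  T = record
    { ∇       = ∇X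
    ; ∇-cong  = λ U≈U′ → pre-cong (SY.∇-cong (f₊-cong U≈U′))
    ; ∇-joins = ∇X-joins
    }

  private
    module ST = Spacetime T
    module IY = Implication S
    module IX = Implication T

  -- f⁻¹ ∇Y V = f⁻¹ ∇Y f₊ f⁻¹ V = ∇X f⁻¹ V
  pre-∇ : ∀ V → f⁻¹ (SY.∇ V) X.≈ ∇X (f⁻¹ V)
  pre-∇ V = pre-cong (SY.∇-cong (Y.≈-sym (f₊-retracts surj V)))

  -- both sides are the largest b with f⁻¹ a ∧ ∇X b ≤ f⁻¹ c
  pre-⇒ : ∀ a c → f⁻¹ (a SY.⇒ c) X.≈ (f⁻¹ a ST.⇒ f⁻¹ c)
  pre-⇒ a c = IX.⇒-intro pulled-back-elim , X.≤-trans (f₊-unit W) (pre-mono (IY.⇒-intro pushed-elim))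
    where
      open X.≤-Reasoning
      W = f⁻¹ a ST.⇒ f⁻¹ c

      pulled-back-elim : (f⁻¹ a X.∩ ∇X (f⁻¹ (a SY.⇒ c))) X.≤ f⁻¹ c
      pulled-back-elim = begin
        (f⁻¹ a X.∩ ∇X (f⁻¹ (a SY.⇒ c)))     ≲⟨ X.∩-mono X.≤-refl (proj₂ (pre-∇ _)) ⟩
        (f⁻¹ a X.∩ f⁻¹ (SY.∇ (a SY.⇒ c)))   ≈⟨ pre-meets _ _ ⟨
        f⁻¹ (a Y.∩ SY.∇ (a SY.⇒ c))         ≲⟨ pre-mono IY.⇒-elim ⟩
        f⁻¹ c                               ∎

      pushed-elim : (a Y.∩ SY.∇ (f₊ W)) Y.≤ c
      pushed-elim = pre-reflects surj (begin
        f⁻¹ (a Y.∩ SY.∇ (f₊ W))             ≈⟨ pre-meets _ _ ⟩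
        (f⁻¹ a X.∩ ∇X W)                    ≲⟨ IX.⇒-elim ⟩
        f⁻¹ c                               ∎)

  pre-logical : IsLogicalMorphism S T f⁻¹
  pre-logical = record
    { g-cong  = pre-cong
    ; g-joins = pre-joins
    ; g-meet  = pre-meets
    ; g-top   = pre-top
    ; g-∇     = pre-∇
    ; g-⇒     = pre-⇒
    }

corollary5p14 : ∀ {ℓ} {X Y : Set ℓ} (τX : Topology X) (τY : Topology Y)
    (f : X → Y) (cont : Continuous τX τY f) → Alexandroff τY → Surjective f →
    (S : Spacetime τY) →
    Σ (Spacetime τX) (λ T → IsLogicalMorphism S T (pre cont))
corollary5p14 τX τY f cont alex surj S = T , pre-logical
  where open Transport cont alex surj S
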